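{- Let $$F(x,y,z)=\sum_{\ell\ge0}\sum_{m\ge0}\sum_{k\ge0}\frac{\ell+1}{k+\ell+1}\binom{k+\ell+m}{k+\ell}\binom{2k+\ell+m}{k+\ell+m}x^ky^\ell z^m\in\mathbb{Q}[[x,y,z]].$$ Then $\partial_yF=F^2$. -}

module Defs where

open import Data.Nat using (ℕ; zero; suc; _∸_) renaming (_+_ to _+ℕ_; _*_ to _*ℕ_)
open import Data.Nat.Combinatorics using (_C_)
open import Data.Integer using (+_)
open import Data.Rational using (ℚ; _+_; _*_; _/_)

-- Formal power series in Q[[x,y,z]], represented by coefficient functions:
-- S k l m is the coefficient of x^k y^l z^m.
Series3 : Set
Series3 = ℕ → ℕ → ℕ → ℚ

ℕ→ℚ : ℕ → ℚ
ℕ→ℚ n = (+ n) / 1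

sumTo : ℕ → (ℕ → ℚ) → ℚ
sumTo zero    g = g 0
sumTo (suc n) g = sumTo n g + g (suc n)

_⋆_ : Series3 → Series3 → Series3
(A ⋆ B) k l m =
  sumTo k λ a → sumTo l λ b → sumTo m λ c →
    A a b c * B (k ∸ a) (l ∸ b) (m ∸ c)

∂y : Series3 → Series3
∂y A k l m = ℕ→ℚ (suc l) * A k (suc l) m

F : Series3
F k l m =
  ((+ (suc l)) / suc (k +ℕ l))
    * ℕ→ℚ ((k +ℕ l +ℕ m) C (k +ℕ l))
    * ℕ→ℚ ((2 *ℕ k +ℕ l +ℕ m) C (k +ℕ l +ℕ m))

{-# OPTIONS --safe #-}
-- Let C = 1 + x C² be the Catalan series and u = x / (1 - z)². Expanding C(u) / (1 - z - y C(u)) in y,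
-- its coefficient of x^k y^l z^m is [x^k] C^(l+1) · [z^m] (1 - z)^(-(2k+l+1)); the ballot formula
-- (k+l+1) · [x^k] C^(l+1) = (l+1) · C(2k+l, k) and a trinomial revision of the binomials show that
-- this is the coefficient of F. As ∂_y (A / (B - y A)) = (A / (B - y A))², the identity ∂_y F = F²
-- then reduces, coefficientwise, to C^i C^j = C^(i+j) and (1 - z)^(-i) (1 - z)^(-j) = (1 - z)^(-(i+j)).
-- All coefficients involved are natural numbers, so the identity is proved in ℕ and transported to ℚ.
module Submission where

open import Data.Nat
open import Data.Nat.Properties
open import Data.Nat.Combinatorics using (_C_; nCn≡1; nCk+nC[k+1]≡[n+1]C[k+1])
open import Data.Nat.Tactic.RingSolver using (solve-∀)
open import Algebra.Properties.CommutativeSemigroup +-commutativeSemigroup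
  using (x∙yz≈y∙xz) renaming (interchange to +-interchange)
open import Algebra.Properties.CommutativeSemigroup *-commutativeSemigroup
  using () renaming (interchange to *-interchange)
import Data.Integer as ℤ
import Data.Integer.Properties as ℤ
open import Data.Rational using (ℚ)
import Data.Rational as ℚ
import Data.Rational.Properties as ℚ
open import Data.Rational.Unnormalised using (ℚᵘ; mkℚᵘ; *≡*)
import Data.Rational.Unnormalised as ℚᵘ
import Data.Rational.Unnormalised.Properties as ℚᵘ
open import Relation.Binary.PropositionalEquality
open ≡-Reasoning

open import Defs

sumToℕ : ℕ → (ℕ → ℕ) → ℕ
sumToℕ zero    g = g 0
sumToℕ (suc n) g = sumToℕ n g + g (suc n)

sumToℕ-cong : ∀ n {f g : ℕ → ℕ} → (∀ i → i ≤ n → f i ≡ g i) → sumToℕ n f ≡ sumToℕ n g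
sumToℕ-cong zero    f≗g = f≗g 0 z≤n
sumToℕ-cong (suc n) f≗g =
  cong₂ _+_ (sumToℕ-cong n (λ i i≤n → f≗g i (m≤n⇒m≤1+n i≤n))) (f≗g (suc n) ≤-refl)

sumToℕ-suc : ∀ n (g : ℕ → ℕ) → sumToℕ (suc n) g ≡ g 0 + sumToℕ n (λ i → g (suc i))
sumToℕ-suc zero    g = refl
sumToℕ-suc (suc n) g = trans (cong (_+ g (2 + n)) (sumToℕ-suc n g)) (+-assoc (g 0) _ _)

sumToℕ-zero : ∀ n → sumToℕ n (λ _ → 0) ≡ 0
sumToℕ-zero zero    = refl
sumToℕ-zero (suc n) = trans (+-identityʳ _) (sumToℕ-zero n)

sumToℕ-const : ∀ n c → sumToℕ n (λ _ → c) ≡ suc n * c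
sumToℕ-const zero    c = sym (+-identityʳ c)
sumToℕ-const (suc n) c = trans (cong (_+ c) (sumToℕ-const n c)) (+-comm (suc n * c) c)

sumToℕ-+ : ∀ n (f g : ℕ → ℕ) → sumToℕ n (λ i → f i + g i) ≡ sumToℕ n f + sumToℕ n g
sumToℕ-+ zero    f g = refl
sumToℕ-+ (suc n) f g =
  trans (cong (_+ (f (suc n) + g (suc n))) (sumToℕ-+ n f g))
        (+-interchange (sumToℕ n f) (sumToℕ n g) (f (suc n)) (g (suc n)))

sumToℕ-*ˡ : ∀ n c (f : ℕ → ℕ) → sumToℕ n (λ i → c * f i) ≡ c * sumToℕ n f
sumToℕ-*ˡ zero    c f = refl
sumToℕ-*ˡ (suc n) c f =
  trans (cong (_+ c * f (suc n)) (sumToℕ-*ˡ n c f)) (sym (*-distribˡ-+ c (sumToℕ n f) _))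

sumToℕ-*ʳ : ∀ n c (f : ℕ → ℕ) → sumToℕ n (λ i → f i * c) ≡ sumToℕ n f * c
sumToℕ-*ʳ zero    c f = refl
sumToℕ-*ʳ (suc n) c f =
  trans (cong (_+ f (suc n) * c) (sumToℕ-*ʳ n c f)) (sym (*-distribʳ-+ c (sumToℕ n f) _))

sumToℕ-comm : ∀ n m (f : ℕ → ℕ → ℕ) →
  sumToℕ n (λ a → sumToℕ m (f a)) ≡ sumToℕ m (λ b → sumToℕ n (λ a → f a b))
sumToℕ-comm zero    m f = refl
sumToℕ-comm (suc n) m f =
  trans (cong (_+ sumToℕ m (f (suc n))) (sumToℕ-comm n m f))
        (sym (sumToℕ-+ m (λ b → sumToℕ n (λ a → f a b)) (f (suc n))))

paths : ℕ → ℕ → ℕ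
paths zero    b       = 1
paths (suc a) zero    = 1
paths (suc a) (suc b) = paths a (suc b) + paths (suc a) b

paths-zeroʳ : ∀ a → paths a 0 ≡ 1
paths-zeroʳ zero    = refl
paths-zeroʳ (suc a) = refl

paths-comm : ∀ a b → paths a b ≡ paths b a
paths-comm zero    zero    = refl
paths-comm zero    (suc b) = refl
paths-comm (suc a) zero    = refl
paths-comm (suc a) (suc b) =
  trans (cong₂ _+_ (paths-comm a (suc b)) (paths-comm (suc a) b)) (+-comm (paths (suc b) a) _)

[a+b]Ca≡paths : ∀ a b → (a + b) C a ≡ paths a b
[a+b]Ca≡paths zero    b       = refl
[a+b]Ca≡paths (suc a) zero    = trans (cong (_C suc a) (+-identityʳ (suc a))) (nCn≡1 (suc a))
[a+b]Ca≡paths (suc a) (suc b) = begin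
  suc (a + suc b) C suc a
    ≡⟨ nCk+nC[k+1]≡[n+1]C[k+1] (a + suc b) a ⟨
  (a + suc b) C a + (a + suc b) C suc a
    ≡⟨ cong (λ t → (a + suc b) C a + t C suc a) (+-suc a b) ⟩
  (a + suc b) C a + (suc a + b) C suc a
    ≡⟨ cong₂ _+_ ([a+b]Ca≡paths a (suc b)) ([a+b]Ca≡paths (suc a) b) ⟩
  paths a (suc b) + paths (suc a) b ∎

paths-factorial : ∀ a b → paths a b * (a ! * b !) ≡ (a + b) !
paths-factorial zero    b       = trans (*-identityˡ _) (*-identityˡ _)
paths-factorial (suc a) zero    =
  trans (*-identityˡ _) (trans (*-identityʳ _) (cong _! (sym (+-identityʳ (suc a)))))
paths-factorial (suc a) (suc b) = begin
  (P + Q) * (suc a ! * suc b !)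
    ≡⟨ split P Q a b (a !) (b !) ⟩
  P * (a ! * suc b !) * suc a + Q * (suc a ! * b !) * suc b
    ≡⟨ cong₂ _+_ (cong (_* suc a) (paths-factorial a (suc b)))
                 (cong (_* suc b) (trans (paths-factorial (suc a) b) (cong _! (sym (+-suc a b))))) ⟩
  (a + suc b) ! * suc a + (a + suc b) ! * suc b
    ≡⟨ collect ((a + suc b) !) a b ⟩
  suc (a + suc b) * (a + suc b) ! ∎
  where
  P = paths a (suc b)
  Q = paths (suc a) b
  split : ∀ P Q a b fa fb → (P + Q) * (suc a * fa * (suc b * fb)) ≡
          P * (fa * (suc b * fb)) * suc a + Q * (suc a * fa * fb) * suc b
  split = solve-∀
  collect : ∀ X a b → X * suc a + X * suc b ≡ suc (a + suc b) * X
  collect = solve-∀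

paths-absorb : ∀ a b → suc a * paths (suc a) b ≡ suc b * paths a (suc b)
paths-absorb a b = *-cancelʳ-≡ _ _ (a ! * b !) {{a !* b !≢0}} (begin
  suc a * paths (suc a) b * (a ! * b !)   ≡⟨ shuffle (suc a) (paths (suc a) b) (a !) (b !) ⟩
  paths (suc a) b * (suc a * a ! * b !)   ≡⟨ paths-factorial (suc a) b ⟩
  (suc a + b) !                           ≡⟨ cong _! (+-suc a b) ⟨
  (a + suc b) !                           ≡⟨ paths-factorial a (suc b) ⟨
  paths a (suc b) * (a ! * (suc b * b !)) ≡⟨ shuffle′ (suc b) (paths a (suc b)) (a !) (b !) ⟩
  suc b * paths a (suc b) * (a ! * b !)   ∎)
  where
  shuffle : ∀ s x fa fb → s * x * (fa * fb) ≡ x * (s * fa * fb)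
  shuffle = solve-∀
  shuffle′ : ∀ s x fa fb → x * (fa * (s * fb)) ≡ s * x * (fa * fb)
  shuffle′ = solve-∀

paths-trinomial : ∀ a m b → paths a m * paths (a + m) b ≡ paths b a * paths (b + a) m
paths-trinomial a m b = *-cancelʳ-≡ _ _ (a ! * (m ! * b !)) {{a!m!b!≢0}} (begin
  paths a m * paths (a + m) b * (a ! * (m ! * b !))
    ≡⟨ shuffle (paths a m) (paths (a + m) b) (a !) (m !) (b !) ⟩
  paths (a + m) b * (paths a m * (a ! * m !) * b !)
    ≡⟨ cong (λ t → paths (a + m) b * (t * b !)) (paths-factorial a m) ⟩
  paths (a + m) b * ((a + m) ! * b !)     ≡⟨ paths-factorial (a + m) b ⟩
  (a + m + b) !                           ≡⟨ cong _! (rotate a m b) ⟩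
  (b + a + m) !                           ≡⟨ paths-factorial (b + a) m ⟨
  paths (b + a) m * ((b + a) ! * m !)
    ≡⟨ cong (λ t → paths (b + a) m * (t * m !)) (paths-factorial b a) ⟨
  paths (b + a) m * (paths b a * (b ! * a !) * m !)
    ≡⟨ shuffle′ (paths b a) (paths (b + a) m) (a !) (m !) (b !) ⟩
  paths b a * paths (b + a) m * (a ! * (m ! * b !)) ∎)
  where
  a!m!b!≢0 : NonZero (a ! * (m ! * b !))
  a!m!b!≢0 = m*n≢0 (a !) (m ! * b !) {{a !≢0}} {{m !* b !≢0}}
  shuffle : ∀ x y fa fm fb → x * y * (fa * (fm * fb)) ≡ y * (x * (fa * fm) * fb)
  shuffle = solve-∀
  rotate : ∀ a m b → a + m + b ≡ b + a + m
  rotate = solve-∀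
  shuffle′ : ∀ x y fa fm fb → y * (x * (fb * fa) * fm) ≡ x * y * (fa * (fm * fb))
  shuffle′ = solve-∀

-- negBinom j c = [z^c] (1 - z)^(-j), via (1 - z)^(-(j+1)) = z (1 - z)^(-(j+1)) + (1 - z)^(-j).
negBinom : ℕ → ℕ → ℕ
negBinom zero    zero    = 1
negBinom zero    (suc c) = 0
negBinom (suc j) zero    = 1
negBinom (suc j) (suc c) = negBinom (suc j) c + negBinom j (suc c)

negBinom-zeroʳ : ∀ j → negBinom j 0 ≡ 1
negBinom-zeroʳ zero    = refl
negBinom-zeroʳ (suc j) = refl

negBinom-suc : ∀ p c → negBinom (suc p) c ≡ paths p c
negBinom-suc p       zero    = sym (paths-zeroʳ p)
negBinom-suc zero    (suc c) = trans (+-identityʳ _) (negBinom-suc zero c)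
negBinom-suc (suc p) (suc c) =
  trans (cong₂ _+_ (negBinom-suc (suc p) c) (negBinom-suc p (suc c))) (+-comm (paths (suc p) c) _)

negBinom-conv : ∀ m i j → sumToℕ m (λ c → negBinom i c * negBinom j (m ∸ c)) ≡ negBinom (i + j) m
negBinom-conv zero    i       j =
  trans (cong₂ _*_ (negBinom-zeroʳ i) (negBinom-zeroʳ j)) (sym (negBinom-zeroʳ (i + j)))
negBinom-conv (suc m) zero    j = begin
  sumToℕ (suc m) (λ c → negBinom 0 c * negBinom j (suc m ∸ c))
    ≡⟨ sumToℕ-suc m _ ⟩
  1 * negBinom j (suc m) + sumToℕ m (λ _ → 0)
    ≡⟨ cong₂ _+_ (*-identityˡ _) (sumToℕ-zero m) ⟩
  negBinom j (suc m) + 0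
    ≡⟨ +-identityʳ _ ⟩
  negBinom j (suc m) ∎
negBinom-conv (suc m) (suc i) j = begin
  sumToℕ (suc m) (λ c → negBinom (suc i) c * negBinom j (suc m ∸ c))
    ≡⟨ sumToℕ-suc m _ ⟩
  1 * negBinom j (suc m) + sumToℕ m (λ c → negBinom (suc i) (suc c) * negBinom j (m ∸ c))
    ≡⟨ cong (1 * negBinom j (suc m) +_)
            (trans (sumToℕ-cong m (λ c _ → *-distribʳ-+ _ (negBinom (suc i) c) _))
                   (sumToℕ-+ m _ _)) ⟩
  1 * negBinom j (suc m) + (S₁ + S₂)
    ≡⟨ x∙yz≈y∙xz _ S₁ S₂ ⟩
  S₁ + (1 * negBinom j (suc m) + S₂)
    ≡⟨ cong (λ t → S₁ + (t * negBinom j (suc m) + S₂)) (negBinom-zeroʳ i) ⟨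
  S₁ + (negBinom i 0 * negBinom j (suc m) + S₂)
    ≡⟨ cong (S₁ +_) (sumToℕ-suc m (λ c → negBinom i c * negBinom j (suc m ∸ c))) ⟨
  S₁ + sumToℕ (suc m) (λ c → negBinom i c * negBinom j (suc m ∸ c))
    ≡⟨ cong₂ _+_ (negBinom-conv m (suc i) j) (negBinom-conv (suc m) i j) ⟩
  negBinom (suc i + j) m + negBinom (i + j) (suc m) ∎
  where
  S₁ = sumToℕ m (λ c → negBinom (suc i) c * negBinom j (m ∸ c))
  S₂ = sumToℕ m (λ c → negBinom i (suc c) * negBinom j (m ∸ c))

-- catPow k j = [x^k] C^j for the Catalan series C = 1 + x C², via C^(j+1) = C^j + x C^(j+2).
catPow : ℕ → ℕ → ℕ
catPow zero    j       = 1
catPow (suc k) zero    = 0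
catPow (suc k) (suc j) = catPow (suc k) j + catPow k (suc (suc j))

catPow-conv : ∀ k i j → sumToℕ k (λ a → catPow a i * catPow (k ∸ a) j) ≡ catPow k (i + j)
catPow-conv zero    i       j = refl
catPow-conv (suc k) zero    j = begin
  sumToℕ (suc k) (λ a → catPow a 0 * catPow (suc k ∸ a) j)
    ≡⟨ sumToℕ-suc k _ ⟩
  1 * catPow (suc k) j + sumToℕ k (λ _ → 0)
    ≡⟨ cong₂ _+_ (*-identityˡ _) (sumToℕ-zero k) ⟩
  catPow (suc k) j + 0
    ≡⟨ +-identityʳ _ ⟩
  catPow (suc k) j ∎
catPow-conv (suc k) (suc i) j = begin
  sumToℕ (suc k) (λ a → catPow a (suc i) * catPow (suc k ∸ a) j)
    ≡⟨ sumToℕ-suc k _ ⟩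
  1 * catPow (suc k) j + sumToℕ k (λ a → catPow (suc a) (suc i) * catPow (k ∸ a) j)
    ≡⟨ cong (1 * catPow (suc k) j +_)
            (trans (sumToℕ-cong k (λ a _ → *-distribʳ-+ _ (catPow (suc a) i) _))
                   (sumToℕ-+ k _ _)) ⟩
  1 * catPow (suc k) j + (S₁ + S₂)
    ≡⟨ +-assoc _ S₁ S₂ ⟨
  1 * catPow (suc k) j + S₁ + S₂
    ≡⟨ cong (_+ S₂) (sumToℕ-suc k (λ a → catPow a i * catPow (suc k ∸ a) j)) ⟨
  sumToℕ (suc k) (λ a → catPow a i * catPow (suc k ∸ a) j) + S₂
    ≡⟨ cong₂ _+_ (catPow-conv (suc k) i j) (catPow-conv k (2 + i) j) ⟩
  catPow (suc k) (i + j) + catPow k (2 + i + j) ∎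
  where
  S₁ = sumToℕ k (λ a → catPow (suc a) i * catPow (k ∸ a) j)
  S₂ = sumToℕ k (λ a → catPow a (2 + i) * catPow (k ∸ a) j)

-- The ballot formula [x^(k+1)] C^(j+1) = C(2k+j+2, k+1) - C(2k+j+2, k), stated without subtraction.
catPow-ballot : ∀ k j → catPow (suc k) (suc j) + paths k (2 + k + j) ≡ paths (suc k) (suc (k + j))
catPow-ballot zero      zero    = refl
catPow-ballot zero      (suc j) =
  trans (+-comm (catPow 1 (suc j) + 1) 1) (cong suc (catPow-ballot zero j))
catPow-ballot k@(suc c) zero    = begin
  catPow k 2 + paths k (2 + k + 0)
    ≡⟨ cong (λ t → catPow k 2 + paths k (2 + t)) (+-identityʳ k) ⟩
  catPow k 2 + (paths c (2 + k) + paths k (suc k))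
    ≡⟨ +-assoc (catPow k 2) _ _ ⟨
  catPow k 2 + paths c (2 + k) + paths k (suc k)
    ≡⟨ cong (_+ paths k (suc k)) ballot-c ⟩
  paths k (suc k) + paths k (suc k)
    ≡⟨ cong (paths k (suc k) +_) (paths-comm k (suc k)) ⟩
  paths k (suc k) + paths (suc k) k
    ≡⟨ cong (λ t → paths k (suc t) + paths (suc k) t) (+-identityʳ k) ⟨
  paths (suc k) (suc (k + 0)) ∎
  where
  ballot-c : catPow k 2 + paths c (2 + k) ≡ paths k (suc k)
  ballot-c = subst (λ t → catPow k 2 + paths c (2 + t) ≡ paths k (suc t))
                   (+-comm c 1) (catPow-ballot c 1)
-- The recursive calls are made in the with: the where block only receives c, so from there the
-- call at (k , j) = (suc c , j) would look increasing to the termination checker.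
catPow-ballot k@(suc c) (suc j)
  with ih-k ← catPow-ballot k j | ih-c ← catPow-ballot c (2 + j) = begin
  catPow (suc k) (suc j) + catPow k (3 + j) + (paths c (suc n) + paths k n)
    ≡⟨ regroup (catPow (suc k) (suc j)) (catPow k (3 + j)) (paths c (suc n)) (paths k n) ⟩
  (catPow (suc k) (suc j) + paths k n) + (catPow k (3 + j) + paths c (suc n))
    ≡⟨ cong₂ _+_ ballot-k ballot-c ⟩
  paths (suc k) (suc (k + j)) + paths k n
    ≡⟨ +-comm _ (paths k n) ⟩
  paths k n + paths (suc k) (suc (k + j))
    ≡⟨ cong (λ t → paths k n + paths (suc k) t) (+-suc k j) ⟨
  paths k n + paths (suc k) (k + suc j) ∎
  where
  n = suc (k + suc j)
  regroup : ∀ x y z w → x + y + (z + w) ≡ (x + w) + (y + z)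
  regroup = solve-∀
  ballot-k : catPow (suc k) (suc j) + paths k n ≡ paths (suc k) (suc (k + j))
  ballot-k = subst (λ t → catPow (suc k) (suc j) + paths k (suc t) ≡ paths (suc k) (suc (k + j)))
                   (sym (+-suc k j)) ih-k
  ballot-c : catPow k (3 + j) + paths c (suc n) ≡ paths k n
  ballot-c = subst (λ t → catPow k (3 + j) + paths c (2 + t) ≡ paths k (suc t))
                   (+-suc c (suc j)) ih-c

catPow-closed : ∀ k l → suc (k + l) * catPow k (suc l) ≡ suc l * paths k (k + l)
catPow-closed zero    l = refl
catPow-closed (suc c) l = +-cancelʳ-≡ (s * y) (s * x) (suc l * z) (begin
  s * x + s * y          ≡⟨ *-distribˡ-+ s x y ⟨
  s * (x + y)            ≡⟨ cong (s *_) (catPow-ballot c l) ⟩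
  s * z                  ≡⟨ cong (_* z) (split c l) ⟩
  (suc l + suc c) * z    ≡⟨ *-distribʳ-+ z (suc l) (suc c) ⟩
  suc l * z + suc c * z  ≡⟨ cong (suc l * z +_) (paths-absorb c (suc (c + l))) ⟩
  suc l * z + s * y      ∎)
  where
  s = suc (suc (c + l))
  x = catPow (suc c) (suc l)
  y = paths c (2 + c + l)
  z = paths (suc c) (suc (c + l))
  split : ∀ c l → suc (suc (c + l)) ≡ suc l + suc c
  split = solve-∀

Series3ℕ : Set
Series3ℕ = ℕ → ℕ → ℕ → ℕ

_⋆ℕ_ : Series3ℕ → Series3ℕ → Series3ℕ
(A ⋆ℕ B) k l m =
  sumToℕ k λ a → sumToℕ l λ b → sumToℕ m λ c →
    A a b c * B (k ∸ a) (l ∸ b) (m ∸ c)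

∂yℕ : Series3ℕ → Series3ℕ
∂yℕ A k l m = suc l * A k (suc l) m

Fℕ : Series3ℕ
Fℕ k l m = catPow k (suc l) * negBinom (suc (k + k + l)) m

Fℕ-closed : ∀ k l m → suc (k + l) * Fℕ k l m ≡ suc l * (paths (k + l) m * paths (k + l + m) k)
Fℕ-closed k l m = begin
  suc (k + l) * (catPow k (suc l) * negBinom (suc (k + k + l)) m)
    ≡⟨ *-assoc (suc (k + l)) (catPow k (suc l)) _ ⟨
  suc (k + l) * catPow k (suc l) * negBinom (suc (k + k + l)) m
    ≡⟨ cong₂ _*_ (catPow-closed k l) (negBinom-suc (k + k + l) m) ⟩
  suc l * paths k (k + l) * paths (k + k + l) m
    ≡⟨ *-assoc (suc l) (paths k (k + l)) _ ⟩
  suc l * (paths k (k + l) * paths (k + k + l) m)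
    ≡⟨ cong (λ t → suc l * (paths k (k + l) * paths t m)) (+-assoc k k l) ⟩
  suc l * (paths k (k + l) * paths (k + (k + l)) m)
    ≡⟨ cong (suc l *_) (paths-trinomial (k + l) m k) ⟨
  suc l * (paths (k + l) m * paths (k + l + m) k) ∎

Fℕ-conv : ∀ a b a′ b′ m →
  sumToℕ m (λ c → Fℕ a b c * Fℕ a′ b′ (m ∸ c)) ≡
  catPow a (suc b) * catPow a′ (suc b′) * negBinom (suc (a + a′ + (a + a′) + suc (b + b′))) m
Fℕ-conv a b a′ b′ m = begin
  sumToℕ m (λ c → x * negBinom p c * (x′ * negBinom p′ (m ∸ c)))
    ≡⟨ sumToℕ-cong m (λ c _ → *-interchange x (negBinom p c) x′ (negBinom p′ (m ∸ c))) ⟩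
  sumToℕ m (λ c → x * x′ * (negBinom p c * negBinom p′ (m ∸ c)))
    ≡⟨ sumToℕ-*ˡ m (x * x′) _ ⟩
  x * x′ * sumToℕ m (λ c → negBinom p c * negBinom p′ (m ∸ c))
    ≡⟨ cong (x * x′ *_) (negBinom-conv m p p′) ⟩
  x * x′ * negBinom (p + p′) m
    ≡⟨ cong (λ t → x * x′ * negBinom t m) (regroup a b a′ b′) ⟩
  x * x′ * negBinom (suc (a + a′ + (a + a′) + suc (b + b′))) m ∎
  where
  x  = catPow a (suc b)
  x′ = catPow a′ (suc b′)
  p  = suc (a + a + b)
  p′ = suc (a′ + a′ + b′)
  regroup : ∀ a b a′ b′ →
            suc (a + a + b) + suc (a′ + a′ + b′) ≡ suc (a + a′ + (a + a′) + suc (b + b′))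
  regroup = solve-∀

∂yℕFℕ≡Fℕ⋆ℕFℕ : ∀ k l m → ∂yℕ Fℕ k l m ≡ (Fℕ ⋆ℕ Fℕ) k l m
∂yℕFℕ≡Fℕ⋆ℕFℕ k l m = sym (begin
  (Fℕ ⋆ℕ Fℕ) k l m
    ≡⟨ sumToℕ-cong k (λ a a≤k → sumToℕ-cong l (λ b b≤l → sum-over-z a≤k b≤l)) ⟩
  sumToℕ k (λ a → sumToℕ l (λ b → w a b * d))
    ≡⟨ sumToℕ-comm k l (λ a b → w a b * d) ⟩
  sumToℕ l (λ b → sumToℕ k (λ a → w a b * d))
    ≡⟨ sumToℕ-cong l (λ b b≤l →
         trans (sumToℕ-*ʳ k d (λ a → w a b)) (cong (_* d) (sum-over-x b≤l))) ⟩
  sumToℕ l (λ _ → catPow k (2 + l) * d)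
    ≡⟨ sumToℕ-const l _ ⟩
  suc l * (catPow k (2 + l) * d) ∎)
  where
  d = negBinom (suc (k + k + suc l)) m
  w : ℕ → ℕ → ℕ
  w a b = catPow a (suc b) * catPow (k ∸ a) (suc (l ∸ b))
  sum-over-z : ∀ {a b} → a ≤ k → b ≤ l →
    sumToℕ m (λ c → Fℕ a b c * Fℕ (k ∸ a) (l ∸ b) (m ∸ c)) ≡ w a b * d
  sum-over-z {a} {b} a≤k b≤l = trans (Fℕ-conv a b (k ∸ a) (l ∸ b) m)
    (cong₂ (λ s t → w a b * negBinom (suc (s + s + suc t)) m) (m+[n∸m]≡n a≤k) (m+[n∸m]≡n b≤l))
  sum-over-x : ∀ {b} → b ≤ l → sumToℕ k (λ a → w a b) ≡ catPow k (2 + l)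
  sum-over-x {b} b≤l = trans (catPow-conv k (suc b) (suc (l ∸ b)))
    (cong (λ t → catPow k (suc t)) (trans (+-suc b (l ∸ b)) (cong suc (m+[n∸m]≡n b≤l))))

fromℚᵘ-homo-+ : ∀ p q → ℚ.fromℚᵘ (p ℚᵘ.+ q) ≡ ℚ.fromℚᵘ p ℚ.+ ℚ.fromℚᵘ q
fromℚᵘ-homo-+ p q = ℚ.toℚᵘ-injective (ℚᵘ.≃-trans (ℚ.toℚᵘ-fromℚᵘ (p ℚᵘ.+ q))
  (ℚᵘ.≃-sym (ℚᵘ.≃-trans (ℚ.toℚᵘ-homo-+ (ℚ.fromℚᵘ p) (ℚ.fromℚᵘ q))
                        (ℚᵘ.+-cong (ℚ.toℚᵘ-fromℚᵘ p) (ℚ.toℚᵘ-fromℚᵘ q)))))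

fromℚᵘ-homo-* : ∀ p q → ℚ.fromℚᵘ (p ℚᵘ.* q) ≡ ℚ.fromℚᵘ p ℚ.* ℚ.fromℚᵘ q
fromℚᵘ-homo-* p q = ℚ.toℚᵘ-injective (ℚᵘ.≃-trans (ℚ.toℚᵘ-fromℚᵘ (p ℚᵘ.* q))
  (ℚᵘ.≃-sym (ℚᵘ.≃-trans (ℚ.toℚᵘ-homo-* (ℚ.fromℚᵘ p) (ℚ.fromℚᵘ q))
                        (ℚᵘ.*-cong (ℚ.toℚᵘ-fromℚᵘ p) (ℚ.toℚᵘ-fromℚᵘ q)))))

ℕ→ℚᵘ : ℕ → ℚᵘ
ℕ→ℚᵘ n = mkℚᵘ (ℤ.+ n) 0

ℕ→ℚᵘ-+ : ∀ a b → ℕ→ℚᵘ (a + b) ℚᵘ.≃ ℕ→ℚᵘ a ℚᵘ.+ ℕ→ℚᵘ b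
ℕ→ℚᵘ-+ a b = *≡* (cong (ℤ._* ℤ.1ℤ) (begin
  ℤ.+ (a + b)                        ≡⟨ ℤ.pos-+ a b ⟩
  ℤ.+ a ℤ.+ ℤ.+ b                    ≡⟨ cong₂ ℤ._+_ (ℤ.*-identityʳ (ℤ.+ a)) (ℤ.*-identityʳ (ℤ.+ b)) ⟨
  ℤ.+ a ℤ.* ℤ.1ℤ ℤ.+ ℤ.+ b ℤ.* ℤ.1ℤ  ∎))

ℕ→ℚᵘ-* : ∀ a b → ℕ→ℚᵘ (a * b) ℚᵘ.≃ ℕ→ℚᵘ a ℚᵘ.* ℕ→ℚᵘ b
ℕ→ℚᵘ-* a b = *≡* (cong (ℤ._* ℤ.1ℤ) (ℤ.pos-* a b))

ℕ→ℚ-+ : ∀ a b → ℕ→ℚ (a + b) ≡ ℕ→ℚ a ℚ.+ ℕ→ℚ b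
ℕ→ℚ-+ a b = trans (ℚ.fromℚᵘ-cong (ℕ→ℚᵘ-+ a b)) (fromℚᵘ-homo-+ (ℕ→ℚᵘ a) (ℕ→ℚᵘ b))

ℕ→ℚ-* : ∀ a b → ℕ→ℚ (a * b) ≡ ℕ→ℚ a ℚ.* ℕ→ℚ b
ℕ→ℚ-* a b = trans (ℚ.fromℚᵘ-cong (ℕ→ℚᵘ-* a b)) (fromℚᵘ-homo-* (ℕ→ℚᵘ a) (ℕ→ℚᵘ b))

p/[1+q]*x≡y : ∀ p q x y → suc q * y ≡ p * x → (ℤ.+ p ℚ./ suc q) ℚ.* ℕ→ℚ x ≡ ℕ→ℚ y
p/[1+q]*x≡y p q x y [1+q]y≡px =
  trans (sym (fromℚᵘ-homo-* r (ℕ→ℚᵘ x))) (ℚ.fromℚᵘ-cong {r ℚᵘ.* ℕ→ℚᵘ x} {ℕ→ℚᵘ y} (*≡* cross))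
  where
  r = mkℚᵘ (ℤ.+ p) q
  cross : ℤ.+ p ℤ.* ℤ.+ x ℤ.* ℤ.1ℤ ≡ ℤ.+ y ℤ.* ℤ.+ (suc q * 1)
  cross = begin
    ℤ.+ p ℤ.* ℤ.+ x ℤ.* ℤ.1ℤ  ≡⟨ ℤ.*-identityʳ _ ⟩
    ℤ.+ p ℤ.* ℤ.+ x           ≡⟨ ℤ.pos-* p x ⟨
    ℤ.+ (p * x)               ≡⟨ cong ℤ.+_ (trans (sym [1+q]y≡px) (reorder q y)) ⟩
    ℤ.+ (y * (suc q * 1))     ≡⟨ ℤ.pos-* y (suc q * 1) ⟩
    ℤ.+ y ℤ.* ℤ.+ (suc q * 1) ∎
    where
    reorder : ∀ q y → suc q * y ≡ y * (suc q * 1)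
    reorder = solve-∀

sumTo-cong : ∀ n {f g : ℕ → ℚ} → (∀ i → f i ≡ g i) → sumTo n f ≡ sumTo n g
sumTo-cong zero    f≗g = f≗g 0
sumTo-cong (suc n) f≗g = cong₂ ℚ._+_ (sumTo-cong n f≗g) (f≗g (suc n))

sumTo-ℕ→ℚ : ∀ n {f : ℕ → ℚ} {g : ℕ → ℕ} → (∀ i → f i ≡ ℕ→ℚ (g i)) → sumTo n f ≡ ℕ→ℚ (sumToℕ n g)
sumTo-ℕ→ℚ zero    f≗g = f≗g 0
sumTo-ℕ→ℚ (suc n) {g = g} f≗g =
  trans (cong₂ ℚ._+_ (sumTo-ℕ→ℚ n f≗g) (f≗g (suc n))) (sym (ℕ→ℚ-+ (sumToℕ n g) (g (suc n))))

⋆-cong : ∀ {A A′ B B′ : Series3} →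
  (∀ k l m → A k l m ≡ A′ k l m) → (∀ k l m → B k l m ≡ B′ k l m) →
  ∀ k l m → (A ⋆ B) k l m ≡ (A′ ⋆ B′) k l m
⋆-cong A≗A′ B≗B′ k l m =
  sumTo-cong k λ a → sumTo-cong l λ b → sumTo-cong m λ c →
    cong₂ ℚ._*_ (A≗A′ a b c) (B≗B′ (k ∸ a) (l ∸ b) (m ∸ c))

infix 30 ↑_

↑_ : Series3ℕ → Series3
(↑ A) k l m = ℕ→ℚ (A k l m)

↑-∂y : ∀ A k l m → ∂y (↑ A) k l m ≡ (↑ ∂yℕ A) k l m
↑-∂y A k l m = sym (ℕ→ℚ-* (suc l) (A k (suc l) m))

↑-⋆ : ∀ A B k l m → (↑ A ⋆ ↑ B) k l m ≡ (↑ (A ⋆ℕ B)) k l m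
↑-⋆ A B k l m =
  sumTo-ℕ→ℚ k λ a → sumTo-ℕ→ℚ l λ b → sumTo-ℕ→ℚ m λ c →
    sym (ℕ→ℚ-* (A a b c) (B (k ∸ a) (l ∸ b) (m ∸ c)))

F≡↑Fℕ : ∀ k l m → F k l m ≡ (↑ Fℕ) k l m
F≡↑Fℕ k l m = begin
  r ℚ.* ℕ→ℚ X ℚ.* ℕ→ℚ Y    ≡⟨ ℚ.*-assoc r (ℕ→ℚ X) (ℕ→ℚ Y) ⟩
  r ℚ.* (ℕ→ℚ X ℚ.* ℕ→ℚ Y)  ≡⟨ cong (r ℚ.*_) (ℕ→ℚ-* X Y) ⟨
  r ℚ.* ℕ→ℚ (X * Y)         ≡⟨ p/[1+q]*x≡y (suc l) (k + l) (X * Y) (Fℕ k l m) closed ⟩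
  ℕ→ℚ (Fℕ k l m)            ∎
  where
  r = ℤ.+ suc l ℚ./ suc (k + l)
  X = (k + l + m) C (k + l)
  Y = (2 * k + l + m) C (k + l + m)
  reorder : ∀ k l m → 2 * k + l + m ≡ k + l + m + k
  reorder = solve-∀
  Y≡paths : Y ≡ paths (k + l + m) k
  Y≡paths = trans (cong (_C (k + l + m)) (reorder k l m)) ([a+b]Ca≡paths (k + l + m) k)
  closed : suc (k + l) * Fℕ k l m ≡ suc l * (X * Y)
  closed = trans (Fℕ-closed k l m)
                 (cong (suc l *_) (sym (cong₂ _*_ ([a+b]Ca≡paths (k + l) m) Y≡paths)))

lemma3 : ∀ (k l m : ℕ) → ∂y F k l m ≡ (F ⋆ F) k l m
lemma3 k l m = begin
  ∂y F k l m            ≡⟨ cong (ℕ→ℚ (suc l) ℚ.*_) (F≡↑Fℕ k (suc l) m) ⟩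
  ∂y (↑ Fℕ) k l m       ≡⟨ ↑-∂y Fℕ k l m ⟩
  (↑ ∂yℕ Fℕ) k l m      ≡⟨ cong ℕ→ℚ (∂yℕFℕ≡Fℕ⋆ℕFℕ k l m) ⟩
  (↑ (Fℕ ⋆ℕ Fℕ)) k l m  ≡⟨ ↑-⋆ Fℕ Fℕ k l m ⟨
  (↑ Fℕ ⋆ ↑ Fℕ) k l m   ≡⟨ ⋆-cong F≡↑Fℕ F≡↑Fℕ k l m ⟨
  (F ⋆ F) k l m         ∎
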